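{- Every deduction in $\mathbf{I}$ can be transformed into a deduction in $\mathbf{I}$ of the same conclusion from (occurrences of) the same undischarged assumptions in which every application of an introduction rule ($\land I$, $\supset I$, $\lor I$) discharges exactly one major assumption.
   Context: Formulas of intuitionistic propositional logic are built from atomic formulas using the connectives $\bot$ (0-ary), $\land$, $\lor$, $\supset$. The natural deduction system $\mathbf{I}$ has tree-shaped deductions with assumptions at the leaves, grouped into assumption classes (occurrences of the same formula; a rule discharging a class discharges all its members). Rules: - $\land I$: from deductions of $A$, of $B$, and of $C$ from $[A\land B]$, conclude $C$. - $\supset I$: from a deduction of $B$ from $[A]$ and a deduction of $C$ from $[A\supset B]$, conclude $C$. - $\lor I$: from a deduction of $A$ (or of $B$) and a deduction of $C$ from $[A\lor B]$, conclude $C$. - $\land E$: from $A\land B$ and a deduction of $C$ from $[A],[B]$, conclude $C$. - $\supset E$: from $A\supset B$, $A$, and a deduction of $C$ from $[B]$, conclude $C$. - $\lor E$: from $A\lor B$, a deduction of $C$ from $[A]$ and one of $C$ from $[B]$, conclude $C$. - $\bot E$: from $\bot$ conclude $C$ (with $C$ atomic). A single assumption occurrence is a deduction. Standing convention: no rule discharges vacuously above an arbitrary premise (the premise $C$ above which a class is discharged). In $\land I$, $\supset I$, $\lor I$, the discharged occurrences of $A\land B$, $A\supset B$, $A\lor B$ respectively (discharged above the premise $C$) are the major assumptions discharged by that application. -}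

module Defs where

open import Data.Nat using (ℕ; zero; suc; _+_; _<_)
open import Data.Bool using (Bool; true; false; if_then_else_)
open import Data.List using (List; _∷_; [])
open import Data.List.Membership.Propositional using (_∈_)
open import Data.List.Relation.Unary.Any using (here; there)
open import Relation.Binary.PropositionalEquality using (_≡_; refl)
open import Data.Product using (_×_)
open import Data.Sum using (_⊎_)
open import Data.Unit using (⊤)

infixr 6 _∧_ _∨_
infixr 5 _⊃_

data Form : Set where
  atom : ℕ → Form
  ⊥'   : Form
  _∧_  : Form → Form → Form
  _∨_  : Form → Form → Form
  _⊃_  : Form → Form → Form

-- The context Γ lists the assumption classes
-- available (each entry is one class, labelled by its formula); an
-- assumption occurrence is a leaf 'ass x' pointing at its class x.
-- A rule discharging a class above a premise extends the context of that
-- premise by the new class (so all its occurrences are discharged).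
data Ded (Γ : List Form) : Form → Set where
  ass : ∀ {A} → A ∈ Γ → Ded Γ A
  ∧I  : ∀ {A B C} → Ded Γ A → Ded Γ B → Ded ((A ∧ B) ∷ Γ) C → Ded Γ C
  ⊃I  : ∀ {A B C} → Ded (A ∷ Γ) B → Ded ((A ⊃ B) ∷ Γ) C → Ded Γ C
  ∨I₁ : ∀ {A B C} → Ded Γ A → Ded ((A ∨ B) ∷ Γ) C → Ded Γ C
  ∨I₂ : ∀ {A B C} → Ded Γ B → Ded ((A ∨ B) ∷ Γ) C → Ded Γ C
  -- ∧E : A∧B, [A],[B]⋯C ⊢ C   (in the premise context: B is index 0, A index 1)
  ∧E  : ∀ {A B C} → Ded Γ (A ∧ B) → Ded (B ∷ A ∷ Γ) C → Ded Γ C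
  ⊃E  : ∀ {A B C} → Ded Γ (A ⊃ B) → Ded Γ A → Ded (B ∷ Γ) C → Ded Γ C
  ∨E  : ∀ {A B C} → Ded Γ (A ∨ B) → Ded (A ∷ Γ) C → Ded (B ∷ Γ) C → Ded Γ C
  ⊥E  : ∀ {n} → Ded Γ ⊥' → Ded Γ (atom n)

sameVar : ∀ {Γ : List Form} {A B : Form} → A ∈ Γ → B ∈ Γ → Bool
sameVar (here _)  (here _)  = true
sameVar (here _)  (there _) = false
sameVar (there _) (here _)  = false
sameVar (there x) (there y) = sameVar x y

count : ∀ {Γ A C} → A ∈ Γ → Ded Γ C → ℕ
count x (ass y)     = if sameVar x y then 1 else 0
count x (∧I d e f)  = count x d + count x e + count (there x) f
count x (⊃I d f)    = count (there x) d + count (there x) f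
count x (∨I₁ d f)   = count x d + count (there x) f
count x (∨I₂ d f)   = count x d + count (there x) f
count x (∧E d f)    = count x d + count (there (there x)) f
count x (⊃E d e f)  = count x d + count x e + count (there x) f
count x (∨E d e f)  = count x d + count (there x) e + count (there x) f
count x (⊥E d)      = count x d

-- Standing convention: no rule discharges vacuously above the premise C.
-- For ⊃I the discharge of [A] above the premise B may be vacuous.
WF : ∀ {Γ C} → Ded Γ C → Set
WF (ass _)     = ⊤
WF (∧I d e f)  = WF d × WF e × WF f × 0 < count (here refl) f
WF (⊃I d f)    = WF d × WF f × 0 < count (here refl) f
WF (∨I₁ d f)   = WF d × WF f × 0 < count (here refl) f
WF (∨I₂ d f)   = WF d × WF f × 0 < count (here refl) f
WF (∧E d f)    = WF d × WF f × (0 < count (there (here refl)) f ⊎ 0 < count (here refl) f)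
WF (⊃E d e f)  = WF d × WF e × WF f × 0 < count (here refl) f
WF (∨E d e f)  = WF d × WF e × WF f × 0 < count (here refl) e × 0 < count (here refl) f
WF (⊥E d)      = WF d

OneMajor : ∀ {Γ C} → Ded Γ C → Set
OneMajor (ass _)     = ⊤
OneMajor (∧I d e f)  = OneMajor d × OneMajor e × OneMajor f × count (here refl) f ≡ 1
OneMajor (⊃I d f)    = OneMajor d × OneMajor f × count (here refl) f ≡ 1
OneMajor (∨I₁ d f)   = OneMajor d × OneMajor f × count (here refl) f ≡ 1
OneMajor (∨I₂ d f)   = OneMajor d × OneMajor f × count (here refl) f ≡ 1
OneMajor (∧E d f)    = OneMajor d × OneMajor f
OneMajor (⊃E d e f)  = OneMajor d × OneMajor e × OneMajor f
OneMajor (∨E d e f)  = OneMajor d × OneMajor e × OneMajor f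
OneMajor (⊥E d)      = OneMajor d

-- Replace each introduction by one with a single fresh major assumption, and
-- substitute that one-major deduction of the major formula for every occurrence
-- of the class the original introduction discharged.  An assumption class stays
-- open iff it was open before: occurrences inside the substituted deduction are
-- multiplied by the number k ≥ 1 of discharged occurrences, and k > 0 is exactly
-- the standing convention against vacuous discharge.
module Submission where

open import Defs
open import Data.Nat using (ℕ; zero; suc; _+_; _*_; _<_; z<s)
open import Data.Nat.Properties using (+-identityʳ; *-identityˡ; *-zeroʳ; +-comm; m≤m+n; m≤n+m; <-≤-trans)
open import Data.Nat.Tactic.RingSolver using (solve-∀)
open import Data.Bool using (true; false)
open import Data.List using (List; _∷_; []; _++_)
open import Data.List.Membership.Propositional using (_∈_)
open import Data.List.Membership.Propositional.Properties using (∈-insert)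
open import Data.List.Relation.Unary.Any using (here; there)
open import Data.Product using (Σ; Σ-syntax; _×_; _,_)
open import Data.Sum using (_⊎_; inj₁; inj₂; map)
open import Data.Sum.Function.Propositional using (_⊎-⇔_)
open import Data.Unit using (tt)
open import Function.Bundles using (_⇔_; mk⇔; module Equivalence)
open Equivalence using (to; from)
open import Function.Construct.Identity using (⇔-id)
open import Function.Construct.Symmetry using (⇔-sym)
open import Function.Construct.Composition using (_⇔-∘_)
open import Relation.Binary.PropositionalEquality using (_≡_; refl; sym; trans; cong; subst; module ≡-Reasoning)

private
  variable
    A B C E : Form
    Γ : List Form

SameSign : ℕ → ℕ → Set
SameSign m n = (0 < m) ⇔ (0 < n)

sameSign-≡ : ∀ {m n} → m ≡ n → SameSign m n
sameSign-≡ refl = ⇔-id _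

0<+⇔ : ∀ m {n} → (0 < m + n) ⇔ (0 < m ⊎ 0 < n)
0<+⇔ m {n} = mk⇔ (split m) join
  where
  split : ∀ m → 0 < m + n → 0 < m ⊎ 0 < n
  split zero    0<n = inj₂ 0<n
  split (suc m) _   = inj₁ z<s
  join : 0 < m ⊎ 0 < n → 0 < m + n
  join (inj₁ 0<m) = <-≤-trans 0<m (m≤m+n m n)
  join (inj₂ 0<n) = <-≤-trans 0<n (m≤n+m n m)

sameSign-+ : ∀ {m m′ n n′} → SameSign m m′ → SameSign n n′ → SameSign (m + n) (m′ + n′)
sameSign-+ {m} {m′} m≈ n≈ = ⇔-sym (0<+⇔ m′) ⇔-∘ ((m≈ ⊎-⇔ n≈) ⇔-∘ 0<+⇔ m)

sameSign-*ˡ : ∀ {k} n → 0 < k → SameSign n (k * n)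
sameSign-*ˡ {suc k} zero    _ rewrite *-zeroʳ k = ⇔-id _
sameSign-*ˡ {suc k} (suc n) _ = mk⇔ (λ _ → z<s) (λ _ → z<s)

-- The summand `+ 0` is the count of an outer class in the leaf `ass (here refl)`
-- closing the one-major deduction that gets substituted.
sameSign-discharge : ∀ {p p′ c c′ k} → 0 < k → SameSign p p′ → SameSign c c′ →
  SameSign (p + c) (c′ + k * (p′ + 0))
sameSign-discharge {p} {p′} {c} 0<k p≈ c≈ =
  sameSign-+ c≈ (sameSign-*ˡ (p′ + 0) 0<k ⇔-∘ (sameSign-≡ (sym (+-identityʳ p′)) ⇔-∘ p≈))
    ⇔-∘ sameSign-≡ (+-comm p c)

sameVar-refl : (x : A ∈ Γ) → sameVar x x ≡ true
sameVar-refl (here _)  = refl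
sameVar-refl (there x) = sameVar-refl x

count-ass-self : (x : A ∈ Γ) → count x (ass x) ≡ 1
count-ass-self x rewrite sameVar-refl x = refl

module _ {E : Form} where

  weaken∈ : ∀ Ξ → A ∈ Ξ ++ Γ → A ∈ Ξ ++ E ∷ Γ
  weaken∈ []      x         = there x
  weaken∈ (_ ∷ Ξ) (here p)  = here p
  weaken∈ (_ ∷ Ξ) (there x) = there (weaken∈ Ξ x)

  sameVar-weaken∈ : ∀ Ξ (x : A ∈ Ξ ++ Γ) (y : B ∈ Ξ ++ Γ) →
    sameVar (weaken∈ Ξ x) (weaken∈ Ξ y) ≡ sameVar x y
  sameVar-weaken∈ []      x         y         = refl
  sameVar-weaken∈ (_ ∷ Ξ) (here _)  (here _)  = refl
  sameVar-weaken∈ (_ ∷ Ξ) (here _)  (there _) = refl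
  sameVar-weaken∈ (_ ∷ Ξ) (there _) (here _)  = refl
  sameVar-weaken∈ (_ ∷ Ξ) (there x) (there y) = sameVar-weaken∈ Ξ x y

  sameVar-∈-insert-weaken∈ : ∀ Ξ (y : B ∈ Ξ ++ Γ) → sameVar (∈-insert Ξ) (weaken∈ Ξ y) ≡ false
  sameVar-∈-insert-weaken∈ []      y         = refl
  sameVar-∈-insert-weaken∈ (_ ∷ Ξ) (here _)  = refl
  sameVar-∈-insert-weaken∈ (_ ∷ Ξ) (there y) = sameVar-∈-insert-weaken∈ Ξ y

  sameVar-weaken∈-∈-insert : ∀ Ξ (x : A ∈ Ξ ++ Γ) → sameVar (weaken∈ Ξ x) (∈-insert Ξ) ≡ false
  sameVar-weaken∈-∈-insert []      x         = refl
  sameVar-weaken∈-∈-insert (_ ∷ Ξ) (here _)  = refl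
  sameVar-weaken∈-∈-insert (_ ∷ Ξ) (there x) = sameVar-weaken∈-∈-insert Ξ x

  data Insertion (Ξ : List Form) {Γ} : ∀ {A} → A ∈ Ξ ++ E ∷ Γ → Set where
    inserted : Insertion Ξ (∈-insert Ξ)
    weakened : (y : A ∈ Ξ ++ Γ) → Insertion Ξ (weaken∈ Ξ y)

  insertion : ∀ Ξ (x : A ∈ Ξ ++ E ∷ Γ) → Insertion Ξ x
  insertion []      (here refl) = inserted
  insertion []      (there y)   = weakened y
  insertion (_ ∷ Ξ) (here p)    = weakened (here p)
  insertion (_ ∷ Ξ) (there x) with insertion Ξ x
  ... | inserted   = inserted
  ... | weakened y = weakened (there y)

  weaken : ∀ Ξ → Ded (Ξ ++ Γ) C → Ded (Ξ ++ E ∷ Γ) C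
  weaken Ξ (ass x)    = ass (weaken∈ Ξ x)
  weaken Ξ (∧I d e f) = ∧I (weaken Ξ d) (weaken Ξ e) (weaken (_ ∷ Ξ) f)
  weaken Ξ (⊃I d f)   = ⊃I (weaken (_ ∷ Ξ) d) (weaken (_ ∷ Ξ) f)
  weaken Ξ (∨I₁ d f)  = ∨I₁ (weaken Ξ d) (weaken (_ ∷ Ξ) f)
  weaken Ξ (∨I₂ d f)  = ∨I₂ (weaken Ξ d) (weaken (_ ∷ Ξ) f)
  weaken Ξ (∧E d f)   = ∧E (weaken Ξ d) (weaken (_ ∷ _ ∷ Ξ) f)
  weaken Ξ (⊃E d e f) = ⊃E (weaken Ξ d) (weaken Ξ e) (weaken (_ ∷ Ξ) f)
  weaken Ξ (∨E d e f) = ∨E (weaken Ξ d) (weaken (_ ∷ Ξ) e) (weaken (_ ∷ Ξ) f)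
  weaken Ξ (⊥E d)     = ⊥E (weaken Ξ d)

  count-weaken : ∀ Ξ (y : A ∈ Ξ ++ Γ) (d : Ded (Ξ ++ Γ) C) →
    count (weaken∈ Ξ y) (weaken Ξ d) ≡ count y d
  count-weaken Ξ y (ass x) rewrite sameVar-weaken∈ Ξ y x = refl
  count-weaken Ξ y (∧I d e f)
    rewrite count-weaken Ξ y d | count-weaken Ξ y e | count-weaken (_ ∷ Ξ) (there y) f = refl
  count-weaken Ξ y (⊃I d f)
    rewrite count-weaken (_ ∷ Ξ) (there y) d | count-weaken (_ ∷ Ξ) (there y) f = refl
  count-weaken Ξ y (∨I₁ d f)
    rewrite count-weaken Ξ y d | count-weaken (_ ∷ Ξ) (there y) f = refl
  count-weaken Ξ y (∨I₂ d f)
    rewrite count-weaken Ξ y d | count-weaken (_ ∷ Ξ) (there y) f = refl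
  count-weaken Ξ y (∧E d f)
    rewrite count-weaken Ξ y d | count-weaken (_ ∷ _ ∷ Ξ) (there (there y)) f = refl
  count-weaken Ξ y (⊃E d e f)
    rewrite count-weaken Ξ y d | count-weaken Ξ y e | count-weaken (_ ∷ Ξ) (there y) f = refl
  count-weaken Ξ y (∨E d e f)
    rewrite count-weaken Ξ y d | count-weaken (_ ∷ Ξ) (there y) e | count-weaken (_ ∷ Ξ) (there y) f = refl
  count-weaken Ξ y (⊥E d) = count-weaken Ξ y d

  count-∈-insert-weaken : ∀ Ξ (d : Ded (Ξ ++ Γ) C) → count (∈-insert {v = E} Ξ) (weaken Ξ d) ≡ 0
  count-∈-insert-weaken Ξ (ass x) rewrite sameVar-∈-insert-weaken∈ Ξ x = refl
  count-∈-insert-weaken Ξ (∧I d e f)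
    rewrite count-∈-insert-weaken Ξ d | count-∈-insert-weaken Ξ e | count-∈-insert-weaken (_ ∷ Ξ) f = refl
  count-∈-insert-weaken Ξ (⊃I d f)
    rewrite count-∈-insert-weaken (_ ∷ Ξ) d | count-∈-insert-weaken (_ ∷ Ξ) f = refl
  count-∈-insert-weaken Ξ (∨I₁ d f)
    rewrite count-∈-insert-weaken Ξ d | count-∈-insert-weaken (_ ∷ Ξ) f = refl
  count-∈-insert-weaken Ξ (∨I₂ d f)
    rewrite count-∈-insert-weaken Ξ d | count-∈-insert-weaken (_ ∷ Ξ) f = refl
  count-∈-insert-weaken Ξ (∧E d f)
    rewrite count-∈-insert-weaken Ξ d | count-∈-insert-weaken (_ ∷ _ ∷ Ξ) f = refl
  count-∈-insert-weaken Ξ (⊃E d e f)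
    rewrite count-∈-insert-weaken Ξ d | count-∈-insert-weaken Ξ e | count-∈-insert-weaken (_ ∷ Ξ) f = refl
  count-∈-insert-weaken Ξ (∨E d e f)
    rewrite count-∈-insert-weaken Ξ d | count-∈-insert-weaken (_ ∷ Ξ) e | count-∈-insert-weaken (_ ∷ Ξ) f = refl
  count-∈-insert-weaken Ξ (⊥E d) = count-∈-insert-weaken Ξ d

  0<count-weaken : ∀ Ξ (y : A ∈ Ξ ++ Γ) (d : Ded (Ξ ++ Γ) C) →
    0 < count y d → 0 < count (weaken∈ Ξ y) (weaken Ξ d)
  0<count-weaken Ξ y d = subst (0 <_) (sym (count-weaken Ξ y d))

  count-here-weaken : ∀ Ξ (f : Ded (A ∷ Ξ ++ Γ) C) → count (here refl) (weaken (A ∷ Ξ) f) ≡ count (here refl) f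
  count-here-weaken Ξ = count-weaken (_ ∷ Ξ) (here refl)

  0<count-here-weaken : ∀ Ξ (f : Ded (A ∷ Ξ ++ Γ) C) →
    0 < count (here refl) f → 0 < count (here refl) (weaken (A ∷ Ξ) f)
  0<count-here-weaken Ξ = 0<count-weaken (_ ∷ Ξ) (here refl)

  weaken-WF : ∀ Ξ (d : Ded (Ξ ++ Γ) C) → WF d → WF (weaken Ξ d)
  weaken-WF Ξ (ass x) _ = tt
  weaken-WF Ξ (∧I d e f) (wd , we , wf , 0<k) =
    weaken-WF Ξ d wd , weaken-WF Ξ e we , weaken-WF (_ ∷ Ξ) f wf , 0<count-here-weaken Ξ f 0<k
  weaken-WF Ξ (⊃I d f) (wd , wf , 0<k) =
    weaken-WF (_ ∷ Ξ) d wd , weaken-WF (_ ∷ Ξ) f wf , 0<count-here-weaken Ξ f 0<k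
  weaken-WF Ξ (∨I₁ d f) (wd , wf , 0<k) =
    weaken-WF Ξ d wd , weaken-WF (_ ∷ Ξ) f wf , 0<count-here-weaken Ξ f 0<k
  weaken-WF Ξ (∨I₂ d f) (wd , wf , 0<k) =
    weaken-WF Ξ d wd , weaken-WF (_ ∷ Ξ) f wf , 0<count-here-weaken Ξ f 0<k
  weaken-WF Ξ (∧E d f) (wd , wf , 0<k) =
    weaken-WF Ξ d wd , weaken-WF (_ ∷ _ ∷ Ξ) f wf ,
    map (0<count-weaken (_ ∷ _ ∷ Ξ) (there (here refl)) f) (0<count-here-weaken (_ ∷ Ξ) f) 0<k
  weaken-WF Ξ (⊃E d e f) (wd , we , wf , 0<k) =
    weaken-WF Ξ d wd , weaken-WF Ξ e we , weaken-WF (_ ∷ Ξ) f wf , 0<count-here-weaken Ξ f 0<k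
  weaken-WF Ξ (∨E d e f) (wd , we , wf , 0<k , 0<l) =
    weaken-WF Ξ d wd , weaken-WF (_ ∷ Ξ) e we , weaken-WF (_ ∷ Ξ) f wf ,
    0<count-here-weaken Ξ e 0<k , 0<count-here-weaken Ξ f 0<l
  weaken-WF Ξ (⊥E d) wd = weaken-WF Ξ d wd

  weaken-OneMajor : ∀ Ξ (d : Ded (Ξ ++ Γ) C) → OneMajor d → OneMajor (weaken Ξ d)
  weaken-OneMajor Ξ (ass x) _ = tt
  weaken-OneMajor Ξ (∧I d e f) (od , oe , of , k≡1) =
    weaken-OneMajor Ξ d od , weaken-OneMajor Ξ e oe , weaken-OneMajor (_ ∷ Ξ) f of ,
    trans (count-here-weaken Ξ f) k≡1
  weaken-OneMajor Ξ (⊃I d f) (od , of , k≡1) =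
    weaken-OneMajor (_ ∷ Ξ) d od , weaken-OneMajor (_ ∷ Ξ) f of , trans (count-here-weaken Ξ f) k≡1
  weaken-OneMajor Ξ (∨I₁ d f) (od , of , k≡1) =
    weaken-OneMajor Ξ d od , weaken-OneMajor (_ ∷ Ξ) f of , trans (count-here-weaken Ξ f) k≡1
  weaken-OneMajor Ξ (∨I₂ d f) (od , of , k≡1) =
    weaken-OneMajor Ξ d od , weaken-OneMajor (_ ∷ Ξ) f of , trans (count-here-weaken Ξ f) k≡1
  weaken-OneMajor Ξ (∧E d f) (od , of) = weaken-OneMajor Ξ d od , weaken-OneMajor (_ ∷ _ ∷ Ξ) f of
  weaken-OneMajor Ξ (⊃E d e f) (od , oe , of) =
    weaken-OneMajor Ξ d od , weaken-OneMajor Ξ e oe , weaken-OneMajor (_ ∷ Ξ) f of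
  weaken-OneMajor Ξ (∨E d e f) (od , oe , of) =
    weaken-OneMajor Ξ d od , weaken-OneMajor (_ ∷ Ξ) e oe , weaken-OneMajor (_ ∷ Ξ) f of
  weaken-OneMajor Ξ (⊥E d) od = weaken-OneMajor Ξ d od

+-*-regroup₂ : ∀ a b p q w → (a + p * w) + (b + q * w) ≡ (a + b) + (p + q) * w
+-*-regroup₂ = solve-∀

+-*-regroup₃ : ∀ a b c p q r w → (a + p * w) + (b + q * w) + (c + r * w) ≡ (a + b + c) + (p + q + r) * w
+-*-regroup₃ = solve-∀

module _ {B : Form} where

  substVar : ∀ Ξ → A ∈ Ξ ++ B ∷ Γ → Ded (Ξ ++ Γ) B → Ded (Ξ ++ Γ) A
  substVar Ξ x D with insertion Ξ x
  ... | inserted   = D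
  ... | weakened y = ass y

  substitute : ∀ Ξ → Ded (Ξ ++ B ∷ Γ) C → Ded (Ξ ++ Γ) B → Ded (Ξ ++ Γ) C
  substitute Ξ (ass x)    D = substVar Ξ x D
  substitute Ξ (∧I d e f) D = ∧I (substitute Ξ d D) (substitute Ξ e D) (substitute (_ ∷ Ξ) f (weaken [] D))
  substitute Ξ (⊃I d f)   D = ⊃I (substitute (_ ∷ Ξ) d (weaken [] D)) (substitute (_ ∷ Ξ) f (weaken [] D))
  substitute Ξ (∨I₁ d f)  D = ∨I₁ (substitute Ξ d D) (substitute (_ ∷ Ξ) f (weaken [] D))
  substitute Ξ (∨I₂ d f)  D = ∨I₂ (substitute Ξ d D) (substitute (_ ∷ Ξ) f (weaken [] D))
  substitute Ξ (∧E d f)   D = ∧E (substitute Ξ d D) (substitute (_ ∷ _ ∷ Ξ) f (weaken [] (weaken [] D)))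
  substitute Ξ (⊃E d e f) D = ⊃E (substitute Ξ d D) (substitute Ξ e D) (substitute (_ ∷ Ξ) f (weaken [] D))
  substitute Ξ (∨E d e f) D =
    ∨E (substitute Ξ d D) (substitute (_ ∷ Ξ) e (weaken [] D)) (substitute (_ ∷ Ξ) f (weaken [] D))
  substitute Ξ (⊥E d)     D = ⊥E (substitute Ξ d D)

  count-substVar : ∀ Ξ (y : A ∈ Ξ ++ Γ) (x : C ∈ Ξ ++ B ∷ Γ) (D : Ded (Ξ ++ Γ) B) →
    count y (substVar Ξ x D) ≡ count (weaken∈ Ξ y) (ass x) + count (∈-insert Ξ) (ass x) * count y D
  count-substVar Ξ y x D with insertion Ξ x
  ... | inserted rewrite sameVar-weaken∈-∈-insert {E = B} Ξ y =
    sym (trans (cong (_* count y D) (count-ass-self (∈-insert Ξ))) (*-identityˡ (count y D)))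
  ... | weakened z rewrite sameVar-weaken∈ {E = B} Ξ y z | sameVar-∈-insert-weaken∈ {E = B} Ξ z =
    sym (+-identityʳ _)

  count-substitute-under : ∀ Ξ (y : A ∈ Ξ ++ Γ) (f : Ded (E ∷ Ξ ++ B ∷ Γ) C) (D : Ded (Ξ ++ Γ) B) →
    count (there y) (substitute (E ∷ Ξ) f (weaken [] D)) ≡
    count (there (weaken∈ Ξ y)) f + count (there (∈-insert Ξ)) f * count y D

  count-substitute : ∀ Ξ (y : A ∈ Ξ ++ Γ) (f : Ded (Ξ ++ B ∷ Γ) C) (D : Ded (Ξ ++ Γ) B) →
    count y (substitute Ξ f D) ≡ count (weaken∈ Ξ y) f + count (∈-insert Ξ) f * count y D
  count-substitute Ξ y (ass x) D = count-substVar Ξ y x D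
  count-substitute Ξ y (∧I d e f) D
    rewrite count-substitute Ξ y d D | count-substitute Ξ y e D | count-substitute-under Ξ y f D =
    +-*-regroup₃ (count (weaken∈ Ξ y) d) (count (weaken∈ Ξ y) e) (count (there (weaken∈ Ξ y)) f)
                 (count (∈-insert Ξ) d) (count (∈-insert Ξ) e) (count (there (∈-insert Ξ)) f) (count y D)
  count-substitute Ξ y (⊃I d f) D
    rewrite count-substitute-under Ξ y d D | count-substitute-under Ξ y f D =
    +-*-regroup₂ (count (there (weaken∈ Ξ y)) d) (count (there (weaken∈ Ξ y)) f)
                 (count (there (∈-insert Ξ)) d) (count (there (∈-insert Ξ)) f) (count y D)
  count-substitute Ξ y (∨I₁ d f) D
    rewrite count-substitute Ξ y d D | count-substitute-under Ξ y f D =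
    +-*-regroup₂ (count (weaken∈ Ξ y) d) (count (there (weaken∈ Ξ y)) f)
                 (count (∈-insert Ξ) d) (count (there (∈-insert Ξ)) f) (count y D)
  count-substitute Ξ y (∨I₂ d f) D
    rewrite count-substitute Ξ y d D | count-substitute-under Ξ y f D =
    +-*-regroup₂ (count (weaken∈ Ξ y) d) (count (there (weaken∈ Ξ y)) f)
                 (count (∈-insert Ξ) d) (count (there (∈-insert Ξ)) f) (count y D)
  count-substitute Ξ y (∧E {A′} d f) D
    rewrite count-substitute Ξ y d D | count-substitute-under (_ ∷ Ξ) (there y) f (weaken [] D)
          | count-weaken {E = A′} [] y D =
    +-*-regroup₂ (count (weaken∈ Ξ y) d) (count (there (there (weaken∈ Ξ y))) f)
                 (count (∈-insert Ξ) d) (count (there (there (∈-insert Ξ))) f) (count y D)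
  count-substitute Ξ y (⊃E d e f) D
    rewrite count-substitute Ξ y d D | count-substitute Ξ y e D | count-substitute-under Ξ y f D =
    +-*-regroup₃ (count (weaken∈ Ξ y) d) (count (weaken∈ Ξ y) e) (count (there (weaken∈ Ξ y)) f)
                 (count (∈-insert Ξ) d) (count (∈-insert Ξ) e) (count (there (∈-insert Ξ)) f) (count y D)
  count-substitute Ξ y (∨E d e f) D
    rewrite count-substitute Ξ y d D | count-substitute-under Ξ y e D | count-substitute-under Ξ y f D =
    +-*-regroup₃ (count (weaken∈ Ξ y) d) (count (there (weaken∈ Ξ y)) e) (count (there (weaken∈ Ξ y)) f)
                 (count (∈-insert Ξ) d) (count (there (∈-insert Ξ)) e) (count (there (∈-insert Ξ)) f) (count y D)
  count-substitute Ξ y (⊥E d) D = count-substitute Ξ y d D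

  count-substitute-under {E = E} Ξ y f D =
    trans (count-substitute (E ∷ Ξ) (there y) f (weaken [] D))
          (cong (λ n → count (there (weaken∈ Ξ y)) f + count (there (∈-insert Ξ)) f * n)
                (count-weaken [] y D))

  count-substitute-unused : ∀ Ξ (y : A ∈ Ξ ++ Γ) (f : Ded (Ξ ++ B ∷ Γ) C) (D : Ded (Ξ ++ Γ) B) →
    count y D ≡ 0 → count y (substitute Ξ f D) ≡ count (weaken∈ Ξ y) f
  count-substitute-unused Ξ y f D y∉D = begin
    count y (substitute Ξ f D)   ≡⟨ count-substitute Ξ y f D ⟩
    c + k * count y D            ≡⟨ cong (λ n → c + k * n) y∉D ⟩
    c + k * 0                    ≡⟨ cong (c +_) (*-zeroʳ k) ⟩
    c + 0                        ≡⟨ +-identityʳ c ⟩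
    c                            ∎
    where
    open ≡-Reasoning
    c = count (weaken∈ Ξ y) f
    k = count (∈-insert Ξ) f

  count-here-substitute : ∀ Ξ (f : Ded (E ∷ Ξ ++ B ∷ Γ) C) (D : Ded (Ξ ++ Γ) B) →
    count (here refl) (substitute (E ∷ Ξ) f (weaken [] D)) ≡ count (here refl) f
  count-here-substitute Ξ f D =
    count-substitute-unused (_ ∷ Ξ) (here refl) f (weaken [] D) (count-∈-insert-weaken [] D)

  count-there-here-substitute : ∀ Ξ (f : Ded (A ∷ E ∷ Ξ ++ B ∷ Γ) C) (D : Ded (Ξ ++ Γ) B) →
    count (there (here refl)) (substitute (A ∷ E ∷ Ξ) f (weaken [] (weaken [] D))) ≡ count (there (here refl)) f
  count-there-here-substitute Ξ f D =
    count-substitute-unused (_ ∷ _ ∷ Ξ) (there (here refl)) f (weaken [] (weaken [] D))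
      (trans (count-weaken [] (here refl) (weaken [] D)) (count-∈-insert-weaken [] D))

  0<count-here-substitute : ∀ Ξ (f : Ded (E ∷ Ξ ++ B ∷ Γ) C) (D : Ded (Ξ ++ Γ) B) →
    0 < count (here refl) f → 0 < count (here refl) (substitute (E ∷ Ξ) f (weaken [] D))
  0<count-here-substitute Ξ f D = subst (0 <_) (sym (count-here-substitute Ξ f D))

  substVar-WF : ∀ Ξ (x : A ∈ Ξ ++ B ∷ Γ) (D : Ded (Ξ ++ Γ) B) → WF D → WF (substVar Ξ x D)
  substVar-WF Ξ x D wD with insertion Ξ x
  ... | inserted   = wD
  ... | weakened _ = tt

  substVar-OneMajor : ∀ Ξ (x : A ∈ Ξ ++ B ∷ Γ) (D : Ded (Ξ ++ Γ) B) →
    OneMajor D → OneMajor (substVar Ξ x D)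
  substVar-OneMajor Ξ x D oD with insertion Ξ x
  ... | inserted   = oD
  ... | weakened _ = tt

  substitute-WF : ∀ Ξ (f : Ded (Ξ ++ B ∷ Γ) C) (D : Ded (Ξ ++ Γ) B) →
    WF f → WF D → WF (substitute Ξ f D)
  substitute-WF Ξ (ass x) D _ wD = substVar-WF Ξ x D wD
  substitute-WF Ξ (∧I d e f) D (wd , we , wf , 0<k) wD =
    substitute-WF Ξ d D wd wD , substitute-WF Ξ e D we wD ,
    substitute-WF (_ ∷ Ξ) f (weaken [] D) wf (weaken-WF [] D wD) , 0<count-here-substitute Ξ f D 0<k
  substitute-WF Ξ (⊃I d f) D (wd , wf , 0<k) wD =
    substitute-WF (_ ∷ Ξ) d (weaken [] D) wd (weaken-WF [] D wD) ,
    substitute-WF (_ ∷ Ξ) f (weaken [] D) wf (weaken-WF [] D wD) , 0<count-here-substitute Ξ f D 0<k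
  substitute-WF Ξ (∨I₁ d f) D (wd , wf , 0<k) wD =
    substitute-WF Ξ d D wd wD ,
    substitute-WF (_ ∷ Ξ) f (weaken [] D) wf (weaken-WF [] D wD) , 0<count-here-substitute Ξ f D 0<k
  substitute-WF Ξ (∨I₂ d f) D (wd , wf , 0<k) wD =
    substitute-WF Ξ d D wd wD ,
    substitute-WF (_ ∷ Ξ) f (weaken [] D) wf (weaken-WF [] D wD) , 0<count-here-substitute Ξ f D 0<k
  substitute-WF Ξ (∧E d f) D (wd , wf , 0<k) wD =
    substitute-WF Ξ d D wd wD ,
    substitute-WF (_ ∷ _ ∷ Ξ) f (weaken [] (weaken [] D)) wf
      (weaken-WF [] (weaken [] D) (weaken-WF [] D wD)) ,
    map (subst (0 <_) (sym (count-there-here-substitute Ξ f D)))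
        (0<count-here-substitute (_ ∷ Ξ) f (weaken [] D)) 0<k
  substitute-WF Ξ (⊃E d e f) D (wd , we , wf , 0<k) wD =
    substitute-WF Ξ d D wd wD , substitute-WF Ξ e D we wD ,
    substitute-WF (_ ∷ Ξ) f (weaken [] D) wf (weaken-WF [] D wD) , 0<count-here-substitute Ξ f D 0<k
  substitute-WF Ξ (∨E d e f) D (wd , we , wf , 0<k , 0<l) wD =
    substitute-WF Ξ d D wd wD ,
    substitute-WF (_ ∷ Ξ) e (weaken [] D) we (weaken-WF [] D wD) ,
    substitute-WF (_ ∷ Ξ) f (weaken [] D) wf (weaken-WF [] D wD) ,
    0<count-here-substitute Ξ e D 0<k , 0<count-here-substitute Ξ f D 0<l
  substitute-WF Ξ (⊥E d) D wd wD = substitute-WF Ξ d D wd wD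

  substitute-OneMajor : ∀ Ξ (f : Ded (Ξ ++ B ∷ Γ) C) (D : Ded (Ξ ++ Γ) B) →
    OneMajor f → OneMajor D → OneMajor (substitute Ξ f D)
  substitute-OneMajor Ξ (ass x) D _ oD = substVar-OneMajor Ξ x D oD
  substitute-OneMajor Ξ (∧I d e f) D (od , oe , of , k≡1) oD =
    substitute-OneMajor Ξ d D od oD , substitute-OneMajor Ξ e D oe oD ,
    substitute-OneMajor (_ ∷ Ξ) f (weaken [] D) of (weaken-OneMajor [] D oD) ,
    trans (count-here-substitute Ξ f D) k≡1
  substitute-OneMajor Ξ (⊃I d f) D (od , of , k≡1) oD =
    substitute-OneMajor (_ ∷ Ξ) d (weaken [] D) od (weaken-OneMajor [] D oD) ,
    substitute-OneMajor (_ ∷ Ξ) f (weaken [] D) of (weaken-OneMajor [] D oD) ,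
    trans (count-here-substitute Ξ f D) k≡1
  substitute-OneMajor Ξ (∨I₁ d f) D (od , of , k≡1) oD =
    substitute-OneMajor Ξ d D od oD ,
    substitute-OneMajor (_ ∷ Ξ) f (weaken [] D) of (weaken-OneMajor [] D oD) ,
    trans (count-here-substitute Ξ f D) k≡1
  substitute-OneMajor Ξ (∨I₂ d f) D (od , of , k≡1) oD =
    substitute-OneMajor Ξ d D od oD ,
    substitute-OneMajor (_ ∷ Ξ) f (weaken [] D) of (weaken-OneMajor [] D oD) ,
    trans (count-here-substitute Ξ f D) k≡1
  substitute-OneMajor Ξ (∧E d f) D (od , of) oD =
    substitute-OneMajor Ξ d D od oD ,
    substitute-OneMajor (_ ∷ _ ∷ Ξ) f (weaken [] (weaken [] D)) of
      (weaken-OneMajor [] (weaken [] D) (weaken-OneMajor [] D oD))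
  substitute-OneMajor Ξ (⊃E d e f) D (od , oe , of) oD =
    substitute-OneMajor Ξ d D od oD , substitute-OneMajor Ξ e D oe oD ,
    substitute-OneMajor (_ ∷ Ξ) f (weaken [] D) of (weaken-OneMajor [] D oD)
  substitute-OneMajor Ξ (∨E d e f) D (od , oe , of) oD =
    substitute-OneMajor Ξ d D od oD ,
    substitute-OneMajor (_ ∷ Ξ) e (weaken [] D) oe (weaken-OneMajor [] D oD) ,
    substitute-OneMajor (_ ∷ Ξ) f (weaken [] D) of (weaken-OneMajor [] D oD)
  substitute-OneMajor Ξ (⊥E d) D od oD = substitute-OneMajor Ξ d D od oD

OneMajorForm : Ded Γ C → Set
OneMajorForm {Γ} {C} d =
  Σ[ d′ ∈ Ded Γ C ] WF d′ × OneMajor d′ ×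
    (∀ {A} (x : A ∈ Γ) → SameSign (count x d) (count x d′))

substitute-oneMajorForm : (d : Ded Γ C) (f : Ded (B ∷ Γ) C) (D : Ded Γ B) →
  WF f → OneMajor f → WF D → OneMajor D →
  (∀ {A} (x : A ∈ Γ) → SameSign (count x d) (count (there x) f + count (here refl) f * count x D)) →
  OneMajorForm d
substitute-oneMajorForm _ f D wf of wD oD same =
  substitute [] f D , substitute-WF [] f D wf wD , substitute-OneMajor [] f D of oD ,
  λ x → sameSign-≡ (sym (count-substitute [] x f D)) ⇔-∘ same x

oneMajorForm : (d : Ded Γ C) → WF d → OneMajorForm d
oneMajorForm (ass x) _ = ass x , tt , tt , λ _ → ⇔-id _
oneMajorForm (∧I d e f) (wd , we , wf , 0<k) =
  let d′ , wd′ , od′ , d≈ = oneMajorForm d wd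
      e′ , we′ , oe′ , e≈ = oneMajorForm e we
      f′ , wf′ , of′ , f≈ = oneMajorForm f wf
  in substitute-oneMajorForm (∧I d e f) f′ (∧I d′ e′ (ass (here refl)))
       wf′ of′ (wd′ , we′ , tt , z<s) (od′ , oe′ , tt , refl)
       λ x → sameSign-discharge (to (f≈ (here refl)) 0<k) (sameSign-+ (d≈ x) (e≈ x)) (f≈ (there x))
oneMajorForm (⊃I d f) (wd , wf , 0<k) =
  let d′ , wd′ , od′ , d≈ = oneMajorForm d wd
      f′ , wf′ , of′ , f≈ = oneMajorForm f wf
  in substitute-oneMajorForm (⊃I d f) f′ (⊃I d′ (ass (here refl)))
       wf′ of′ (wd′ , tt , z<s) (od′ , tt , refl)
       λ x → sameSign-discharge (to (f≈ (here refl)) 0<k) (d≈ (there x)) (f≈ (there x))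
oneMajorForm (∨I₁ d f) (wd , wf , 0<k) =
  let d′ , wd′ , od′ , d≈ = oneMajorForm d wd
      f′ , wf′ , of′ , f≈ = oneMajorForm f wf
  in substitute-oneMajorForm (∨I₁ d f) f′ (∨I₁ d′ (ass (here refl)))
       wf′ of′ (wd′ , tt , z<s) (od′ , tt , refl)
       λ x → sameSign-discharge (to (f≈ (here refl)) 0<k) (d≈ x) (f≈ (there x))
oneMajorForm (∨I₂ d f) (wd , wf , 0<k) =
  let d′ , wd′ , od′ , d≈ = oneMajorForm d wd
      f′ , wf′ , of′ , f≈ = oneMajorForm f wf
  in substitute-oneMajorForm (∨I₂ d f) f′ (∨I₂ d′ (ass (here refl)))
       wf′ of′ (wd′ , tt , z<s) (od′ , tt , refl)
       λ x → sameSign-discharge (to (f≈ (here refl)) 0<k) (d≈ x) (f≈ (there x))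
oneMajorForm (∧E d f) (wd , wf , 0<k) =
  let d′ , wd′ , od′ , d≈ = oneMajorForm d wd
      f′ , wf′ , of′ , f≈ = oneMajorForm f wf
  in ∧E d′ f′ ,
     (wd′ , wf′ , map (to (f≈ (there (here refl)))) (to (f≈ (here refl))) 0<k) ,
     (od′ , of′) ,
     λ x → sameSign-+ (d≈ x) (f≈ (there (there x)))
oneMajorForm (⊃E d e f) (wd , we , wf , 0<k) =
  let d′ , wd′ , od′ , d≈ = oneMajorForm d wd
      e′ , we′ , oe′ , e≈ = oneMajorForm e we
      f′ , wf′ , of′ , f≈ = oneMajorForm f wf
  in ⊃E d′ e′ f′ ,
     (wd′ , we′ , wf′ , to (f≈ (here refl)) 0<k) ,
     (od′ , oe′ , of′) ,
     λ x → sameSign-+ (sameSign-+ (d≈ x) (e≈ x)) (f≈ (there x))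
oneMajorForm (∨E d e f) (wd , we , wf , 0<k , 0<l) =
  let d′ , wd′ , od′ , d≈ = oneMajorForm d wd
      e′ , we′ , oe′ , e≈ = oneMajorForm e we
      f′ , wf′ , of′ , f≈ = oneMajorForm f wf
  in ∨E d′ e′ f′ ,
     (wd′ , we′ , wf′ , to (e≈ (here refl)) 0<k , to (f≈ (here refl)) 0<l) ,
     (od′ , oe′ , of′) ,
     λ x → sameSign-+ (sameSign-+ (d≈ x) (e≈ (there x))) (f≈ (there x))
oneMajorForm (⊥E d) wd =
  let d′ , wd′ , od′ , d≈ = oneMajorForm d wd
  in ⊥E d′ , wd′ , od′ , d≈

mainTheorem3 : ∀ {Γ : List Form} {C : Form} (d : Ded Γ C) → WF d →
    Σ (Ded Γ C) (λ d′ → WF d′ × OneMajor d′ ×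
      (∀ {A : Form} (x : A ∈ Γ) → (0 < count x d → 0 < count x d′) × (0 < count x d′ → 0 < count x d)))
mainTheorem3 d wd =
  let d′ , wd′ , od′ , d≈ = oneMajorForm d wd
  in d′ , wd′ , od′ , λ x → to (d≈ x) , from (d≈ x)
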